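{- For all formulae $A,B$, the formula $(\top^*\wedge(A*B))\to A$ is provable in $LS_{BBI}+IU$, i.e. $\emptyset;\emptyset\vdash w:(\top^*\wedge(A*B))\to A$ is derivable in that calculus for a label variable $w$.
   Context: Formulae: $A ::= p \mid \top\mid\bot\mid\neg A\mid A\vee A\mid A\wedge A\mid A\to A\mid \top^*\mid A*A\mid A\mathrel{ -\!\!*}A$. Labels: $LVar\cup\{\epsilon\}$ ($LVar$ infinite set of label variables, $\epsilon$ a constant). Labelled formula $a:A$; relational atom $(a,b\triangleright c)$. Sequent $\mathcal{G};\Gamma\vdash\Delta$: $\mathcal{G}$ a set of relational atoms, $\Gamma,\Delta$ multisets of labelled formulae; commas denote union. $[y/x]$ ($x$ a label variable) is uniform replacement. $\neg A$ abbreviates $A\to\bot$, $A\vee B$ abbreviates $\neg A\to B$. The calculus $LS_{BBI}$ has the rules (premises $\Rightarrow$ conclusion; fresh = label variable not in conclusion): $id$: axiom $\mathcal{G};\Gamma,w:p\vdash w:p,\Delta$ ($p$ a propositional variable); $cut$: $\mathcal{G};\Gamma\vdash x:A,\Delta$ and $\mathcal{G}';\Gamma',x:A\vdash\Delta'\Rightarrow\mathcal{G},\mathcal{G}';\Gamma,\Gamma'\vdash\Delta,\Delta'$; $\bot L$: axiom $\mathcal{G};\Gamma,w:\bot\vdash\Delta$; $\top R$: axiom $\mathcal{G};\Gamma\vdash w:\top,\Delta$; $\top^*R$: axiom $\mathcal{G};\Gamma\vdash\epsilon:\top^*,\Delta$; $\top^*L$: $(\epsilon,w\triangleright\epsilon),\mathcal{G};\Gamma\vdash\Delta\Rightarrow\mathcal{G};\Gamma,w:\top^*\vdash\Delta$;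 $\wedge L$: $\mathcal{G};\Gamma,w:A,w:B\vdash\Delta\Rightarrow\mathcal{G};\Gamma,w:A\wedge B\vdash\Delta$; $\wedge R$: $\mathcal{G};\Gamma\vdash w:A,\Delta$ and $\mathcal{G};\Gamma\vdash w:B,\Delta\Rightarrow\mathcal{G};\Gamma\vdash w:A\wedge B,\Delta$; $\to L$: $\mathcal{G};\Gamma\vdash w:A,\Delta$ and $\mathcal{G};\Gamma,w:B\vdash\Delta\Rightarrow\mathcal{G};\Gamma,w:A\to B\vdash\Delta$; $\to R$: $\mathcal{G};\Gamma,w:A\vdash w:B,\Delta\Rightarrow\mathcal{G};\Gamma\vdash w:A\to B,\Delta$; $*L$: $(x,y\triangleright z),\mathcal{G};\Gamma,x:A,y:B\vdash\Delta\Rightarrow\mathcal{G};\Gamma,z:A*B\vdash\Delta$ ($x,y$ fresh); $\mathrel{ -\!\!*}R$: $(x,z\triangleright y),\mathcal{G};\Gamma,x:A\vdash y:B,\Delta\Rightarrow\mathcal{G};\Gamma\vdash z:A\mathrel{ -\!\!*}B,\Delta$ ($x,y$ fresh); $*R$: $(x,y\triangleright z),\mathcal{G};\Gamma\vdash x:A,z:A*B,\Delta$ and $(x,y\triangleright z),\mathcal{G};\Gamma\vdash y:B,z:A*B,\Delta\Rightarrow(x,y\triangleright z),\mathcal{G};\Gamma\vdash z:A*B,\Delta$; $\mathrel{ -\!\!*}L$: $(x,y\triangleright z),\mathcal{G};\Gamma,y:A\mathrel{ -\!\!*}B\vdash x:A,\Delta$ and $(x,y\triangleright z),\mathcal{G};\Gamma,y:A\mathrel{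 -\!\!*}B,z:B\vdash\Delta\Rightarrow(x,y\triangleright z),\mathcal{G};\Gamma,y:A\mathrel{ -\!\!*}B\vdash\Delta$; $E$: $(y,x\triangleright z),(x,y\triangleright z),\mathcal{G};\Gamma\vdash\Delta\Rightarrow(x,y\triangleright z),\mathcal{G};\Gamma\vdash\Delta$; $A$: $(u,w\triangleright z),(y,v\triangleright w),(x,y\triangleright z),(u,v\triangleright x),\mathcal{G};\Gamma\vdash\Delta\Rightarrow(x,y\triangleright z),(u,v\triangleright x),\mathcal{G};\Gamma\vdash\Delta$ ($w$ fresh); $U$: $(x,\epsilon\triangleright x),\mathcal{G};\Gamma\vdash\Delta\Rightarrow\mathcal{G};\Gamma\vdash\Delta$; $A_C$: $(x,w\triangleright x),(y,y\triangleright w),(x,y\triangleright x),\mathcal{G};\Gamma\vdash\Delta\Rightarrow(x,y\triangleright x),\mathcal{G};\Gamma\vdash\Delta$ ($w$ fresh); $Eq_1$: $(\epsilon,w'\triangleright w'),\mathcal{G}[w'/w];\Gamma[w'/w]\vdash\Delta[w'/w]\Rightarrow(\epsilon,w\triangleright w'),\mathcal{G};\Gamma\vdash\Delta$; $Eq_2$: same premise $\Rightarrow(\epsilon,w'\triangleright w),\mathcal{G};\Gamma\vdash\Delta$ (in $Eq_1,Eq_2$, $w$ a label variable). $LS_{BBI}+IU$ adds the rule $IU$: $(\epsilon,y\triangleright\epsilon),\mathcal{G}[\epsilon/x];\Gamma[\epsilon/x]\vdash\Delta[\epsilon/x]\Rightarrow(x,y\triangleright\epsilon),\mathcal{G};\Gamma\vdash\Delta$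 ($x$ a label variable). -}

module Defs where

open import Data.Nat using (ℕ)
open import Data.Nat as ℕ using ()
open import Data.List using (List; []; _∷_; _++_; map)
open import Data.List.Membership.Propositional using (_∈_)
open import Data.List.Relation.Binary.Permutation.Propositional using (_↭_)
open import Data.List.Relation.Unary.Any using (Any)
open import Relation.Binary.PropositionalEquality using (_≡_)
open import Relation.Nullary using (¬_)
open import Relation.Binary.PropositionalEquality using (_≢_)
open import Data.Product using (_×_)
open import Data.Sum using (_⊎_)
open import Data.Bool using (Bool; true; false; if_then_else_)

infixr 5 _⇒_
infixr 6 _∨ᶠ_
infixr 7 _∧ᶠ_
infixr 8 _✶_ _−✶_
data Formula : Set where
  pv   : ℕ → Formula
  ⊤ᶠ   : Formula
  ⊥ᶠ   : Formula
  _∧ᶠ_ : Formula → Formula → Formula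
  _⇒_  : Formula → Formula → Formula
  ⊤*   : Formula
  _✶_  : Formula → Formula → Formula
  _−✶_ : Formula → Formula → Formula

¬ᶠ_ : Formula → Formula
¬ᶠ A = A ⇒ ⊥ᶠ

_∨ᶠ_ : Formula → Formula → Formula
A ∨ᶠ B = ¬ᶠ A ⇒ B

data Label : Set where
  lv : ℕ → Label
  ε  : Label

record LFormula : Set where
  constructor _∶_
  field
    lab  : Label
    form : Formula

record RAtom : Set where
  constructor ⟨_,_▷_⟩
  field
    left  : Label
    right : Label
    res   : Label

data OccL (x : ℕ) : Label → Set where
  here : OccL x (lv x)

data OccR (x : ℕ) : RAtom → Set where
  occ₁ : ∀ {a b c} → OccL x a → OccR x ⟨ a , b ▷ c ⟩
  occ₂ : ∀ {a b c} → OccL x b → OccR x ⟨ a , b ▷ c ⟩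
  occ₃ : ∀ {a b c} → OccL x c → OccR x ⟨ a , b ▷ c ⟩

data OccF (x : ℕ) : LFormula → Set where
  occ : ∀ {a A} → OccL x a → OccF x (a ∶ A)

-- Sequent  𝒢 ; Γ ⊢ Δ  (𝒢 a set, represented by a list considered up to
-- same elements; Γ, Δ multisets, represented by lists up to permutation)
infix 2 _︔_⊢_
record Sequent : Set where
  constructor _︔_⊢_
  field
    rel : List RAtom
    ant : List LFormula
    suc : List LFormula

OccS : ℕ → Sequent → Set
OccS x (G ︔ Γ ⊢ Δ) = Any (OccR x) G ⊎ (Any (OccF x) Γ ⊎ Any (OccF x) Δ)

Fresh : ℕ → Sequent → Set
Fresh x S = ¬ OccS x S

substL : Label → ℕ → Label → Label
substL y x (lv z) = if z ℕ.≡ᵇ x then y else lv z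
substL y x ε = ε

substR : Label → ℕ → RAtom → RAtom
substR y x ⟨ a , b ▷ c ⟩ = ⟨ substL y x a , substL y x b ▷ substL y x c ⟩

substF : Label → ℕ → LFormula → LFormula
substF y x (a ∶ A) = substL y x a ∶ A

_≈ˢ_ : List RAtom → List RAtom → Set
G ≈ˢ G' = (∀ {r} → r ∈ G → r ∈ G') × (∀ {r} → r ∈ G' → r ∈ G)

-- Derivability in LS_BBI + IU.
-- The rule `struct` expresses that 𝒢 is a set and Γ, Δ are multisets
-- (sequents are identified up to these equalities); it is not a logical rule.
data ⊢IU : Sequent → Set where
  struct : ∀ {G G' Γ Γ' Δ Δ'} → G ≈ˢ G' → Γ ↭ Γ' → Δ ↭ Δ' →
           ⊢IU (G ︔ Γ ⊢ Δ) → ⊢IU (G' ︔ Γ' ⊢ Δ')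
  id   : ∀ {G Γ Δ w p} → ⊢IU (G ︔ (w ∶ pv p) ∷ Γ ⊢ (w ∶ pv p) ∷ Δ)
  cut  : ∀ {G G' Γ Γ' Δ Δ' x A} →
         ⊢IU (G ︔ Γ ⊢ (x ∶ A) ∷ Δ) → ⊢IU (G' ︔ (x ∶ A) ∷ Γ' ⊢ Δ') →
         ⊢IU ((G ++ G') ︔ (Γ ++ Γ') ⊢ (Δ ++ Δ'))
  ⊥L   : ∀ {G Γ Δ w} → ⊢IU (G ︔ (w ∶ ⊥ᶠ) ∷ Γ ⊢ Δ)
  ⊤R   : ∀ {G Γ Δ w} → ⊢IU (G ︔ Γ ⊢ (w ∶ ⊤ᶠ) ∷ Δ)
  ⊤*R  : ∀ {G Γ Δ} → ⊢IU (G ︔ Γ ⊢ (ε ∶ ⊤*) ∷ Δ)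
  ⊤*L  : ∀ {G Γ Δ w} → ⊢IU (⟨ ε , w ▷ ε ⟩ ∷ G ︔ Γ ⊢ Δ) →
         ⊢IU (G ︔ (w ∶ ⊤*) ∷ Γ ⊢ Δ)
  ∧L   : ∀ {G Γ Δ w A B} → ⊢IU (G ︔ (w ∶ A) ∷ (w ∶ B) ∷ Γ ⊢ Δ) →
         ⊢IU (G ︔ (w ∶ (A ∧ᶠ B)) ∷ Γ ⊢ Δ)
  ∧R   : ∀ {G Γ Δ w A B} → ⊢IU (G ︔ Γ ⊢ (w ∶ A) ∷ Δ) →
         ⊢IU (G ︔ Γ ⊢ (w ∶ B) ∷ Δ) → ⊢IU (G ︔ Γ ⊢ (w ∶ (A ∧ᶠ B)) ∷ Δ)
  ⇒L   : ∀ {G Γ Δ w A B} → ⊢IU (G ︔ Γ ⊢ (w ∶ A) ∷ Δ) →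
         ⊢IU (G ︔ (w ∶ B) ∷ Γ ⊢ Δ) → ⊢IU (G ︔ (w ∶ (A ⇒ B)) ∷ Γ ⊢ Δ)
  ⇒R   : ∀ {G Γ Δ w A B} → ⊢IU (G ︔ (w ∶ A) ∷ Γ ⊢ (w ∶ B) ∷ Δ) →
         ⊢IU (G ︔ Γ ⊢ (w ∶ (A ⇒ B)) ∷ Δ)
  ✶L   : ∀ {G Γ Δ x y z A B} →
         Fresh x (G ︔ (z ∶ (A ✶ B)) ∷ Γ ⊢ Δ) →
         Fresh y (G ︔ (z ∶ (A ✶ B)) ∷ Γ ⊢ Δ) → x ≢ y →
         ⊢IU (⟨ lv x , lv y ▷ z ⟩ ∷ G ︔ (lv x ∶ A) ∷ (lv y ∶ B) ∷ Γ ⊢ Δ) →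
         ⊢IU (G ︔ (z ∶ (A ✶ B)) ∷ Γ ⊢ Δ)
  −✶R  : ∀ {G Γ Δ x y z A B} →
         Fresh x (G ︔ Γ ⊢ (z ∶ (A −✶ B)) ∷ Δ) →
         Fresh y (G ︔ Γ ⊢ (z ∶ (A −✶ B)) ∷ Δ) → x ≢ y →
         ⊢IU (⟨ lv x , z ▷ lv y ⟩ ∷ G ︔ (lv x ∶ A) ∷ Γ ⊢ (lv y ∶ B) ∷ Δ) →
         ⊢IU (G ︔ Γ ⊢ (z ∶ (A −✶ B)) ∷ Δ)
  ✶R   : ∀ {G Γ Δ x y z A B} →
         ⊢IU (⟨ x , y ▷ z ⟩ ∷ G ︔ Γ ⊢ (x ∶ A) ∷ (z ∶ (A ✶ B)) ∷ Δ) →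
         ⊢IU (⟨ x , y ▷ z ⟩ ∷ G ︔ Γ ⊢ (y ∶ B) ∷ (z ∶ (A ✶ B)) ∷ Δ) →
         ⊢IU (⟨ x , y ▷ z ⟩ ∷ G ︔ Γ ⊢ (z ∶ (A ✶ B)) ∷ Δ)
  −✶L  : ∀ {G Γ Δ x y z A B} →
         ⊢IU (⟨ x , y ▷ z ⟩ ∷ G ︔ (y ∶ (A −✶ B)) ∷ Γ ⊢ (x ∶ A) ∷ Δ) →
         ⊢IU (⟨ x , y ▷ z ⟩ ∷ G ︔ (y ∶ (A −✶ B)) ∷ (z ∶ B) ∷ Γ ⊢ Δ) →
         ⊢IU (⟨ x , y ▷ z ⟩ ∷ G ︔ (y ∶ (A −✶ B)) ∷ Γ ⊢ Δ)
  E    : ∀ {G Γ Δ x y z} →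
         ⊢IU (⟨ y , x ▷ z ⟩ ∷ ⟨ x , y ▷ z ⟩ ∷ G ︔ Γ ⊢ Δ) →
         ⊢IU (⟨ x , y ▷ z ⟩ ∷ G ︔ Γ ⊢ Δ)
  A    : ∀ {G Γ Δ x y z u v w} →
         Fresh w (⟨ x , y ▷ z ⟩ ∷ ⟨ u , v ▷ x ⟩ ∷ G ︔ Γ ⊢ Δ) →
         ⊢IU (⟨ u , lv w ▷ z ⟩ ∷ ⟨ y , v ▷ lv w ⟩ ∷ ⟨ x , y ▷ z ⟩ ∷ ⟨ u , v ▷ x ⟩ ∷ G ︔ Γ ⊢ Δ) →
         ⊢IU (⟨ x , y ▷ z ⟩ ∷ ⟨ u , v ▷ x ⟩ ∷ G ︔ Γ ⊢ Δ)
  U    : ∀ {G Γ Δ x} →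
         ⊢IU (⟨ x , ε ▷ x ⟩ ∷ G ︔ Γ ⊢ Δ) → ⊢IU (G ︔ Γ ⊢ Δ)
  AC   : ∀ {G Γ Δ x y w} →
         Fresh w (⟨ x , y ▷ x ⟩ ∷ G ︔ Γ ⊢ Δ) →
         ⊢IU (⟨ x , lv w ▷ x ⟩ ∷ ⟨ y , y ▷ lv w ⟩ ∷ ⟨ x , y ▷ x ⟩ ∷ G ︔ Γ ⊢ Δ) →
         ⊢IU (⟨ x , y ▷ x ⟩ ∷ G ︔ Γ ⊢ Δ)
  Eq₁  : ∀ {G Γ Δ w w'} →
         ⊢IU (⟨ ε , w' ▷ w' ⟩ ∷ map (substR w' w) G ︔ map (substF w' w) Γ ⊢ map (substF w' w) Δ) →
         ⊢IU (⟨ ε , lv w ▷ w' ⟩ ∷ G ︔ Γ ⊢ Δ)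
  Eq₂  : ∀ {G Γ Δ w w'} →
         ⊢IU (⟨ ε , w' ▷ w' ⟩ ∷ map (substR w' w) G ︔ map (substF w' w) Γ ⊢ map (substF w' w) Δ) →
         ⊢IU (⟨ ε , w' ▷ lv w ⟩ ∷ G ︔ Γ ⊢ Δ)
  IU   : ∀ {G Γ Δ x y} →
         ⊢IU (⟨ ε , y ▷ ε ⟩ ∷ map (substR ε x) G ︔ map (substF ε x) Γ ⊢ map (substF ε x) Δ) →
         ⊢IU (⟨ lv x , y ▷ ε ⟩ ∷ G ︔ Γ ⊢ Δ)

-- From ⊤* the world w is ε, by ⊤*L, E and IU.  Splitting ε ⊨ A ✶ B with ✶L
-- gives worlds x ⊨ A and y ⊨ B with (x , y ▷ ε), and IU identifies x with ε
-- as well, so the goal ε ⊨ A closes by the identity on A.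
module Submission where

open import Defs
open import Data.Bool using (true)
open import Data.List using (List; []; _∷_; map)
open import Data.List.Relation.Binary.Permutation.Propositional using (refl; swap)
open import Data.List.Relation.Unary.Any using (Any; here; there)
open import Data.Nat using (ℕ; zero; suc; _⊔_; _<_; _≤_)
open import Data.Nat as ℕ using ()
open import Data.Nat.Properties
  using (≤-refl; n≤1+n; n<1+n; <⇒≢; <⇒≱; m<n⇒m<n⊔o; m<n⇒m<o⊔n)
open import Data.Product using (_,_)
open import Data.Sum using (inj₁; inj₂)
open import Function using () renaming (id to idᶠ)
open import Relation.Binary.PropositionalEquality using (_≡_)

boundL : Label → ℕ
boundL (lv n) = suc n
boundL ε      = 0

boundR : RAtom → ℕ
boundR ⟨ a , b ▷ c ⟩ = boundL a ⊔ (boundL b ⊔ boundL c)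

boundRs : List RAtom → ℕ
boundRs []       = 0
boundRs (r ∷ rs) = boundR r ⊔ boundRs rs

boundFs : List LFormula → ℕ
boundFs []             = 0
boundFs ((a ∶ _) ∷ fs) = boundL a ⊔ boundFs fs

boundS : Sequent → ℕ
boundS (G ︔ Γ ⊢ Δ) = boundRs G ⊔ (boundFs Γ ⊔ boundFs Δ)

OccL⇒<boundL : ∀ {x a} → OccL x a → x < boundL a
OccL⇒<boundL here = ≤-refl

OccR⇒<boundR : ∀ {x r} → OccR x r → x < boundR r
OccR⇒<boundR {r = ⟨ a , b ▷ c ⟩} (occ₁ o) = m<n⇒m<n⊔o _ (OccL⇒<boundL o)
OccR⇒<boundR {r = ⟨ a , b ▷ c ⟩} (occ₂ o) = m<n⇒m<o⊔n (boundL a) (m<n⇒m<n⊔o _ (OccL⇒<boundL o))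
OccR⇒<boundR {r = ⟨ a , b ▷ c ⟩} (occ₃ o) = m<n⇒m<o⊔n (boundL a) (m<n⇒m<o⊔n (boundL b) (OccL⇒<boundL o))

OccRs⇒<boundRs : ∀ {x G} → Any (OccR x) G → x < boundRs G
OccRs⇒<boundRs              (here o)  = m<n⇒m<n⊔o _ (OccR⇒<boundR o)
OccRs⇒<boundRs {G = r ∷ _} (there o) = m<n⇒m<o⊔n (boundR r) (OccRs⇒<boundRs o)

OccFs⇒<boundFs : ∀ {x Γ} → Any (OccF x) Γ → x < boundFs Γ
OccFs⇒<boundFs                    (here (occ o)) = m<n⇒m<n⊔o _ (OccL⇒<boundL o)
OccFs⇒<boundFs {Γ = (a ∶ _) ∷ _} (there o)      = m<n⇒m<o⊔n (boundL a) (OccFs⇒<boundFs o)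

OccS⇒<boundS : ∀ {x} S → OccS x S → x < boundS S
OccS⇒<boundS (G ︔ Γ ⊢ Δ) (inj₁ o)        = m<n⇒m<n⊔o _ (OccRs⇒<boundRs o)
OccS⇒<boundS (G ︔ Γ ⊢ Δ) (inj₂ (inj₁ o)) = m<n⇒m<o⊔n (boundRs G) (m<n⇒m<n⊔o _ (OccFs⇒<boundFs o))
OccS⇒<boundS (G ︔ Γ ⊢ Δ) (inj₂ (inj₂ o)) = m<n⇒m<o⊔n (boundRs G) (m<n⇒m<o⊔n (boundFs Γ) (OccFs⇒<boundFs o))

boundS≤⇒Fresh : ∀ S {x} → boundS S ≤ x → Fresh x S
boundS≤⇒Fresh S S≤x o = <⇒≱ (OccS⇒<boundS S o) S≤x

≡ᵇ-refl : ∀ n → (n ℕ.≡ᵇ n) ≡ true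
≡ᵇ-refl zero    = _≡_.refl
≡ᵇ-refl (suc n) = ≡ᵇ-refl n

exchangeˡ : ∀ {G Γ Δ φ ψ} → ⊢IU (G ︔ ψ ∷ φ ∷ Γ ⊢ Δ) → ⊢IU (G ︔ φ ∷ ψ ∷ Γ ⊢ Δ)
exchangeˡ = struct (idᶠ , idᶠ) (swap _ _ refl) refl

identity : ∀ C {G Γ Δ a} → ⊢IU (G ︔ (a ∶ C) ∷ Γ ⊢ (a ∶ C) ∷ Δ)
identity (pv p)   = id
identity ⊤ᶠ       = ⊤R
identity ⊥ᶠ       = ⊥L
identity (C ∧ᶠ D) = ∧L (∧R (identity C) (exchangeˡ (identity D)))
identity (C ⇒ D)  = ⇒R (exchangeˡ (⇒L (identity C) (identity D)))
identity ⊤* {a = ε} = ⊤*L ⊤*R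
identity ⊤* {G} {Γ} {Δ} {lv x} = ⊤*L (E (IU collapsed))
  where
  collapsed : ⊢IU (⟨ ε , ε ▷ ε ⟩ ∷ map (substR ε x) (⟨ ε , lv x ▷ ε ⟩ ∷ G)
                   ︔ map (substF ε x) Γ ⊢ map (substF ε x) ((lv x ∶ ⊤*) ∷ Δ))
  collapsed rewrite ≡ᵇ-refl x = ⊤*R
identity (C ✶ D) {G} {Γ} {Δ} {a} =
  ✶L (boundS≤⇒Fresh S ≤-refl) (boundS≤⇒Fresh S (n≤1+n _)) (<⇒≢ (n<1+n _))
     (✶R (identity C) (exchangeˡ (identity D)))
  where S = G ︔ (a ∶ (C ✶ D)) ∷ Γ ⊢ (a ∶ (C ✶ D)) ∷ Δ
identity (C −✶ D) {G} {Γ} {Δ} {a} =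
  −✶R (boundS≤⇒Fresh S ≤-refl) (boundS≤⇒Fresh S (n≤1+n _)) (<⇒≢ (n<1+n _))
      (exchangeˡ (−✶L (exchangeˡ (identity C)) (exchangeˡ (identity D))))
  where S = G ︔ (a ∶ (C −✶ D)) ∷ Γ ⊢ (a ∶ (C −✶ D)) ∷ Δ

✶-projectˡ-ε : ∀ C D {G Γ Δ} → ⊢IU (G ︔ (ε ∶ (C ✶ D)) ∷ Γ ⊢ (ε ∶ C) ∷ Δ)
✶-projectˡ-ε C D {G} {Γ} {Δ} =
  ✶L (boundS≤⇒Fresh S ≤-refl) (boundS≤⇒Fresh S (n≤1+n _)) (<⇒≢ (n<1+n _)) (IU collapsed)
  where
  S = G ︔ (ε ∶ (C ✶ D)) ∷ Γ ⊢ (ε ∶ C) ∷ Δ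
  x = boundS S
  collapsed : ⊢IU (⟨ ε , lv (suc x) ▷ ε ⟩ ∷ map (substR ε x) G
                   ︔ map (substF ε x) ((lv x ∶ C) ∷ (lv (suc x) ∶ D) ∷ Γ)
                   ⊢ map (substF ε x) ((ε ∶ C) ∷ Δ))
  collapsed rewrite ≡ᵇ-refl x = identity C

mainTheorem7 : ∀ (A B : Formula) (w : ℕ) →
    ⊢IU ([] ︔ [] ⊢ ((lv w ∶ ((⊤* ∧ᶠ (A ✶ B)) ⇒ A)) ∷ []))
mainTheorem7 C D w = ⇒R (∧L (⊤*L (E (IU collapsed))))
  where
  collapsed : ⊢IU (⟨ ε , ε ▷ ε ⟩ ∷ map (substR ε w) (⟨ ε , lv w ▷ ε ⟩ ∷ [])
                   ︔ map (substF ε w) ((lv w ∶ (C ✶ D)) ∷ []) ⊢ map (substF ε w) ((lv w ∶ C) ∷ []))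
  collapsed rewrite ≡ᵇ-refl w = ✶-projectˡ-ε C D
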